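{- Let $\mathcal{C}$ be a restriction category and $T$ a symmetric monoidal monad on $\mathcal{C}$. Then $T$ is unital domain preserving if and only if the Kleisli category $\mathcal{C}_T$ is a mass category.
   Context: Composition is diagrammatic ($f;g$ means first $f$, then $g$); the right unitor is $\rho_X:X\to X\otimes I$. A gs-monoidal category is a symmetric monoidal category with, for each object $X$, a discharger $!_X:X\to I$ and duplicator $\nabla_X:X\to X\otimes X$, compatible with the monoidal structure, with $\nabla_X$ coassociative, cocommutative, and $(X,\nabla_X,!_X)$ a comonoid. A restriction category is a gs-monoidal category in which every arrow $f:X\to Y$ satisfies $f;\nabla_Y=\nabla_X;(f\otimes f)$. A symmetric monoidal monad $(T,\eta,\mu)$ is a monad whose functor is lax symmetric monoidal with structure $c_{X,Y}:TX\otimes TY\to T(X\otimes Y)$ and $\eta_I:I\to TI$, such that $\eta,\mu$ are monoidal natural transformations. The Kleisli category $\mathcal{C}_T$ has arrows $X\to Y$ the arrows $X\to TY$, composition $f;^\sharp g=f;T(g);\mu$, tensor $f\otimes^\sharp g=(f\otimes g);c$, structural arrows $\nabla_X;\eta_{X\otimes X}$ and $!_X;\eta_I$. For $f:X\to Y$ in a gs-monoidal category, $\mathrm{mass}(f):=f;!_Y$ and $\mathrm{dom}(f):=\nabla_X;(\mathrm{id}_X\otimes(f;!_Y));\rho^{ -1}_X$; a mass category is one with $\mathrm{dom}(f);\mathrm{mass}(f)=\mathrm{mass}(f)$ for all $f$. $T$ is unital domain preserving if $\nabla_{TI};c_{I,I};T(\mathrm{id}_I\otimes !_I)=T(\rho_I)$.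 -}

module Defs where

open import Level using (Level; _⊔_) renaming (suc to lsuc)
open import Relation.Binary using (Rel; IsEquivalence)

-- Composition is written diagrammatically: f ⨾ g means "first f, then g".

record Category (o ℓ e : Level) : Set (lsuc (o ⊔ ℓ ⊔ e)) where
  infixr 9 _⨾_
  infix 4 _≈_
  field
    Obj : Set o
    Hom : Obj → Obj → Set ℓ
    _≈_ : ∀ {X Y} → Rel (Hom X Y) e
    ≈-equiv : ∀ {X Y} → IsEquivalence (_≈_ {X} {Y})
    id : ∀ {X} → Hom X X
    _⨾_ : ∀ {X Y Z} → Hom X Y → Hom Y Z → Hom X Z
    ⨾-assoc : ∀ {W X Y Z} {f : Hom W X} {g : Hom X Y} {h : Hom Y Z} →
              (f ⨾ g) ⨾ h ≈ f ⨾ (g ⨾ h)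
    idˡ : ∀ {X Y} {f : Hom X Y} → id ⨾ f ≈ f
    idʳ : ∀ {X Y} {f : Hom X Y} → f ⨾ id ≈ f
    ⨾-cong : ∀ {X Y Z} {f f' : Hom X Y} {g g' : Hom Y Z} →
             f ≈ f' → g ≈ g' → f ⨾ g ≈ f' ⨾ g'

module _ {o ℓ e : Level} (C : Category o ℓ e) where
  open Category C

  -- Conventions:
  --   α X Y Z : (X ⊗ Y) ⊗ Z → X ⊗ (Y ⊗ Z)
  --   lu X    : X → I ⊗ X      (left unitor, in the paper's direction)
  --   ru X    : X → X ⊗ I      (right unitor ρ_X, as in the paper)
  --   σ X Y   : X ⊗ Y → Y ⊗ X
  record SymmetricMonoidal : Set (o ⊔ ℓ ⊔ e) where
    infixr 10 _⊗₀_ _⊗₁_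
    field
      _⊗₀_ : Obj → Obj → Obj
      I : Obj
      _⊗₁_ : ∀ {X Y X' Y'} → Hom X Y → Hom X' Y' → Hom (X ⊗₀ X') (Y ⊗₀ Y')
      ⊗-id : ∀ {X Y} → id {X} ⊗₁ id {Y} ≈ id
      ⊗-⨾ : ∀ {X Y Z X' Y' Z'} {f : Hom X Y} {g : Hom Y Z} {h : Hom X' Y'} {k : Hom Y' Z'} →
            (f ⨾ g) ⊗₁ (h ⨾ k) ≈ (f ⊗₁ h) ⨾ (g ⊗₁ k)
      ⊗-cong : ∀ {X Y X' Y'} {f f' : Hom X Y} {g g' : Hom X' Y'} →
               f ≈ f' → g ≈ g' → f ⊗₁ g ≈ f' ⊗₁ g'

      α : ∀ X Y Z → Hom ((X ⊗₀ Y) ⊗₀ Z) (X ⊗₀ (Y ⊗₀ Z))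
      α⁻¹ : ∀ X Y Z → Hom (X ⊗₀ (Y ⊗₀ Z)) ((X ⊗₀ Y) ⊗₀ Z)
      α-iso₁ : ∀ {X Y Z} → α X Y Z ⨾ α⁻¹ X Y Z ≈ id
      α-iso₂ : ∀ {X Y Z} → α⁻¹ X Y Z ⨾ α X Y Z ≈ id
      α-nat : ∀ {X Y Z X' Y' Z'} {f : Hom X X'} {g : Hom Y Y'} {h : Hom Z Z'} →
              ((f ⊗₁ g) ⊗₁ h) ⨾ α X' Y' Z' ≈ α X Y Z ⨾ (f ⊗₁ (g ⊗₁ h))

      lu : ∀ X → Hom X (I ⊗₀ X)
      lu⁻¹ : ∀ X → Hom (I ⊗₀ X) X
      lu-iso₁ : ∀ {X} → lu X ⨾ lu⁻¹ X ≈ id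
      lu-iso₂ : ∀ {X} → lu⁻¹ X ⨾ lu X ≈ id
      lu-nat : ∀ {X Y} {f : Hom X Y} → f ⨾ lu Y ≈ lu X ⨾ (id ⊗₁ f)

      ru : ∀ X → Hom X (X ⊗₀ I)
      ru⁻¹ : ∀ X → Hom (X ⊗₀ I) X
      ru-iso₁ : ∀ {X} → ru X ⨾ ru⁻¹ X ≈ id
      ru-iso₂ : ∀ {X} → ru⁻¹ X ⨾ ru X ≈ id
      ru-nat : ∀ {X Y} {f : Hom X Y} → f ⨾ ru Y ≈ ru X ⨾ (f ⊗₁ id)

      σ : ∀ X Y → Hom (X ⊗₀ Y) (Y ⊗₀ X)
      σ-inv : ∀ {X Y} → σ X Y ⨾ σ Y X ≈ id
      σ-nat : ∀ {X Y X' Y'} {f : Hom X X'} {g : Hom Y Y'} →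
              (f ⊗₁ g) ⨾ σ X' Y' ≈ σ X Y ⨾ (g ⊗₁ f)

      pentagon : ∀ {W X Y Z} →
        α (W ⊗₀ X) Y Z ⨾ α W X (Y ⊗₀ Z)
          ≈ (α W X Y ⊗₁ id) ⨾ α W (X ⊗₀ Y) Z ⨾ (id ⊗₁ α X Y Z)
      triangle : ∀ {X Y} → α X I Y ⨾ (id ⊗₁ lu⁻¹ Y) ≈ ru⁻¹ X ⊗₁ id
      hexagon : ∀ {X Y Z} →
        α X Y Z ⨾ σ X (Y ⊗₀ Z) ⨾ α Y Z X
          ≈ (σ X Y ⊗₁ id) ⨾ α Y X Z ⨾ (id ⊗₁ σ X Z)

  module _ (M : SymmetricMonoidal) where
    open SymmetricMonoidal M

    middleFour : ∀ X X' Y Y' → Hom ((X ⊗₀ X') ⊗₀ (Y ⊗₀ Y')) ((X ⊗₀ Y) ⊗₀ (X' ⊗₀ Y'))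
    middleFour X X' Y Y' =
      α X X' (Y ⊗₀ Y') ⨾ (id ⊗₁ (α⁻¹ X' Y Y' ⨾ (σ X' Y ⊗₁ id) ⨾ α Y X' Y'))
        ⨾ α⁻¹ X Y (X' ⊗₀ Y')

    -- gs-monoidal structure: discharger and duplicator on every object,
    -- compatible with the monoidal structure, forming a coassociative,
    -- cocommutative comonoid (NOT required to be natural).
    record GsMonoidal : Set (o ⊔ ℓ ⊔ e) where
      field
        ! : ∀ X → Hom X I
        ∇ : ∀ X → Hom X (X ⊗₀ X)
        !-I : ! I ≈ id
        !-⊗ : ∀ {X Y} → ! (X ⊗₀ Y) ≈ (! X ⊗₁ ! Y) ⨾ lu⁻¹ I
        ∇-I : ∇ I ≈ ru I
        ∇-⊗ : ∀ {X Y} → ∇ (X ⊗₀ Y) ≈ (∇ X ⊗₁ ∇ Y) ⨾ middleFour X X Y Y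
        coassoc : ∀ {X} → ∇ X ⨾ (∇ X ⊗₁ id) ⨾ α X X X ≈ ∇ X ⨾ (id ⊗₁ ∇ X)
        cocomm : ∀ {X} → ∇ X ⨾ σ X X ≈ ∇ X
        counitʳ : ∀ {X} → ∇ X ⨾ (id ⊗₁ ! X) ≈ ru X
        counitˡ : ∀ {X} → ∇ X ⨾ (! X ⊗₁ id) ≈ lu X

    -- restriction category: every arrow commutes with duplication
    IsRestriction : GsMonoidal → Set (o ⊔ ℓ ⊔ e)
    IsRestriction G = ∀ {X Y} (f : Hom X Y) → f ⨾ ∇ Y ≈ ∇ X ⨾ (f ⊗₁ f)
      where open GsMonoidal G

    record SymmetricMonoidalMonad : Set (o ⊔ ℓ ⊔ e) where
      field
        T₀ : Obj → Obj
        T₁ : ∀ {X Y} → Hom X Y → Hom (T₀ X) (T₀ Y)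
        T-id : ∀ {X} → T₁ (id {X}) ≈ id
        T-⨾ : ∀ {X Y Z} {f : Hom X Y} {g : Hom Y Z} → T₁ (f ⨾ g) ≈ T₁ f ⨾ T₁ g
        T-cong : ∀ {X Y} {f g : Hom X Y} → f ≈ g → T₁ f ≈ T₁ g

        η : ∀ X → Hom X (T₀ X)
        μ : ∀ X → Hom (T₀ (T₀ X)) (T₀ X)
        η-nat : ∀ {X Y} {f : Hom X Y} → f ⨾ η Y ≈ η X ⨾ T₁ f
        μ-nat : ∀ {X Y} {f : Hom X Y} → T₁ (T₁ f) ⨾ μ Y ≈ μ X ⨾ T₁ f
        μ-idˡ : ∀ {X} → η (T₀ X) ⨾ μ X ≈ id
        μ-idʳ : ∀ {X} → T₁ (η X) ⨾ μ X ≈ id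
        μ-assoc : ∀ {X} → T₁ (μ X) ⨾ μ X ≈ μ (T₀ X) ⨾ μ X

        c : ∀ X Y → Hom (T₀ X ⊗₀ T₀ Y) (T₀ (X ⊗₀ Y))
        c-nat : ∀ {X Y X' Y'} {f : Hom X X'} {g : Hom Y Y'} →
                (T₁ f ⊗₁ T₁ g) ⨾ c X' Y' ≈ c X Y ⨾ T₁ (f ⊗₁ g)
        c-assoc : ∀ {X Y Z} →
          (c X Y ⊗₁ id) ⨾ c (X ⊗₀ Y) Z ⨾ T₁ (α X Y Z)
            ≈ α (T₀ X) (T₀ Y) (T₀ Z) ⨾ (id ⊗₁ c Y Z) ⨾ c X (Y ⊗₀ Z)
        c-unitˡ : ∀ {X} → lu (T₀ X) ⨾ (η I ⊗₁ id) ⨾ c I X ≈ T₁ (lu X)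
        c-unitʳ : ∀ {X} → ru (T₀ X) ⨾ (id ⊗₁ η I) ⨾ c X I ≈ T₁ (ru X)
        c-sym : ∀ {X Y} → σ (T₀ X) (T₀ Y) ⨾ c Y X ≈ c X Y ⨾ T₁ (σ X Y)

        -- η and μ are monoidal natural transformations
        -- (the unit conditions hold automatically: η_I ⨾ id = η_I, and
        --  η_I ⨾ T η_I ⨾ μ_I = η_I follows from the monad laws)
        η-monoidal : ∀ {X Y} → (η X ⊗₁ η Y) ⨾ c X Y ≈ η (X ⊗₀ Y)
        μ-monoidal : ∀ {X Y} →
          (μ X ⊗₁ μ Y) ⨾ c X Y ≈ c (T₀ X) (T₀ Y) ⨾ T₁ (c X Y) ⨾ μ (X ⊗₀ Y)

    module _ (G : GsMonoidal) (T : SymmetricMonoidalMonad) where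
      open GsMonoidal G
      open SymmetricMonoidalMonad T

      UnitalDomainPreserving : Set e
      UnitalDomainPreserving =
        ∇ (T₀ I) ⨾ c I I ⨾ T₁ (id ⊗₁ ! I) ≈ T₁ (ru I)

record GsData (o ℓ e : Level) : Set (lsuc (o ⊔ ℓ ⊔ e)) where
  infixr 9 _⨾_
  infixr 10 _⊗₀_ _⊗₁_
  infix 4 _≈_
  field
    Obj : Set o
    Hom : Obj → Obj → Set ℓ
    _≈_ : ∀ {X Y} → Rel (Hom X Y) e
    id : ∀ {X} → Hom X X
    _⨾_ : ∀ {X Y Z} → Hom X Y → Hom Y Z → Hom X Z
    _⊗₀_ : Obj → Obj → Obj
    I : Obj
    _⊗₁_ : ∀ {X Y X' Y'} → Hom X Y → Hom X' Y' → Hom (X ⊗₀ X') (Y ⊗₀ Y')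
    ru⁻¹ : ∀ X → Hom (X ⊗₀ I) X
    ! : ∀ X → Hom X I
    ∇ : ∀ X → Hom X (X ⊗₀ X)

  mass : ∀ {X Y} → Hom X Y → Hom X I
  mass {X} {Y} f = f ⨾ ! Y

  dom : ∀ {X Y} → Hom X Y → Hom X X
  dom {X} {Y} f = (∇ X ⨾ (id ⊗₁ mass f)) ⨾ ru⁻¹ X

IsMassCategory : ∀ {o ℓ e} → GsData o ℓ e → Set (o ⊔ ℓ ⊔ e)
IsMassCategory D = ∀ {X Y} (f : Hom X Y) → dom f ⨾ mass f ≈ mass f
  where open GsData D

Kleisli : ∀ {o ℓ e} (C : Category o ℓ e) (M : SymmetricMonoidal C)
          (G : GsMonoidal C M) (T : SymmetricMonoidalMonad C M) → GsData o ℓ e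
Kleisli C M G T = record
  { Obj = Obj
  ; Hom = λ X Y → Hom X (T₀ Y)
  ; _≈_ = _≈_
  ; id = λ {X} → η X
  ; _⨾_ = λ {X} {Y} {Z} f g → f ⨾ T₁ g ⨾ μ Z
  ; _⊗₀_ = _⊗₀_
  ; I = I
  ; _⊗₁_ = λ {X} {Y} {X'} {Y'} f g → (f ⊗₁ g) ⨾ c Y Y'
  ; ru⁻¹ = λ X → ru⁻¹ X ⨾ η X
  ; ! = λ X → ! X ⨾ η I
  ; ∇ = λ X → ∇ X ⨾ η (X ⊗₀ X)
  }
  where
    open Category C
    open SymmetricMonoidal M
    open GsMonoidal G
    open SymmetricMonoidalMonad T

{-# OPTIONS --safe #-}
module Submission where

-- In the Kleisli category the domain of an arrow f : X → TY depends only on its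
-- mass m : X → TI.  Because C is a restriction category, m can be copied, and
-- dom f ⨾♯ mass f works out to m ⨾ u for the single endomorphism
-- u = ∇_TI ⨾ c_{I,I} ⨾ T ρ⁻¹_I of TI.  Hence C_T is a mass category iff u = id
-- (for ⇒ take f = id_TI, whose mass is id).  As !_I = id, unital domain
-- preservation says ∇_TI ⨾ c_{I,I} = T ρ_I, which is u = id because T ρ_I has
-- inverse T ρ⁻¹_I.

open import Defs
open import Level using (Level)
open import Function.Bundles using (Equivalence; _⇔_; mk⇔)
open import Function.Construct.Composition using (_⇔-∘_)
open import Relation.Binary using (Setoid; IsEquivalence)
import Relation.Binary.Reasoning.Setoid as SetoidReasoning

module CategoryReasoning {o ℓ e : Level} (C : Category o ℓ e) where
  open Category C

  homSetoid : Obj → Obj → Setoid ℓ e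
  homSetoid X Y = record { isEquivalence = ≈-equiv {X} {Y} }

  module ≈ {X Y : Obj} = IsEquivalence (≈-equiv {X} {Y})
  module HomReasoning {X Y : Obj} = SetoidReasoning (homSetoid X Y)
  open HomReasoning public

  infixr 8 _⟩⨾⟨_ refl⟩⨾⟨_
  infixl 8 _⟩⨾⟨refl

  _⟩⨾⟨_ : ∀ {X Y Z} {f f' : Hom X Y} {g g' : Hom Y Z} → f ≈ f' → g ≈ g' → f ⨾ g ≈ f' ⨾ g'
  _⟩⨾⟨_ = ⨾-cong

  refl⟩⨾⟨_ : ∀ {X Y Z} {f : Hom X Y} {g g' : Hom Y Z} → g ≈ g' → f ⨾ g ≈ f ⨾ g'
  refl⟩⨾⟨ p = ⨾-cong ≈.refl p

  _⟩⨾⟨refl : ∀ {X Y Z} {f f' : Hom X Y} {g : Hom Y Z} → f ≈ f' → f ⨾ g ≈ f' ⨾ g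
  p ⟩⨾⟨refl = ⨾-cong p ≈.refl

  pullˡ : ∀ {W X Y Z} {a : Hom W X} {b : Hom X Y} {d : Hom W Y} {f : Hom Y Z} →
          a ⨾ b ≈ d → a ⨾ b ⨾ f ≈ d ⨾ f
  pullˡ p = ≈.trans (≈.sym ⨾-assoc) (p ⟩⨾⟨refl)

  extendˡ : ∀ {W X X' Y Z} {a : Hom W X} {b : Hom X Y} {a' : Hom W X'} {b' : Hom X' Y}
            {f : Hom Y Z} → a ⨾ b ≈ a' ⨾ b' → a ⨾ b ⨾ f ≈ a' ⨾ b' ⨾ f
  extendˡ p = ≈.trans (pullˡ p) ⨾-assoc

  ⨾-assoc₃ : ∀ {U V W X Y Z} {a : Hom U V} {b : Hom V W} {d : Hom W X} {f : Hom X Y} {g : Hom Y Z} →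
             (a ⨾ b ⨾ d ⨾ f) ⨾ g ≈ a ⨾ b ⨾ d ⨾ f ⨾ g
  ⨾-assoc₃ = ≈.trans ⨾-assoc (refl⟩⨾⟨ ≈.trans ⨾-assoc (refl⟩⨾⟨ ⨾-assoc))

  cancelˡ : ∀ {X Y Z} {a : Hom X Y} {b : Hom Y X} {f : Hom X Z} → a ⨾ b ≈ id → a ⨾ b ⨾ f ≈ f
  cancelˡ p = ≈.trans (pullˡ p) idˡ

  inverse-square : ∀ {X X' Y Y'} {i : Hom X' X} {i⁻¹ : Hom X X'} {j : Hom Y' Y} {j⁻¹ : Hom Y Y'}
    {f : Hom X Y} {g : Hom X' Y'} →
    i⁻¹ ⨾ i ≈ id → j ⨾ j⁻¹ ≈ id → i ⨾ f ≈ g ⨾ j → i⁻¹ ⨾ g ≈ f ⨾ j⁻¹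
  inverse-square {i = i} {i⁻¹} {j} {j⁻¹} {f} {g} ii⁻¹ jj⁻¹ sq = begin
    i⁻¹ ⨾ g                 ≈⟨ ≈.sym idʳ ⟩
    (i⁻¹ ⨾ g) ⨾ id          ≈⟨ refl⟩⨾⟨ ≈.sym jj⁻¹ ⟩
    (i⁻¹ ⨾ g) ⨾ j ⨾ j⁻¹     ≈⟨ ⨾-assoc ⟩
    i⁻¹ ⨾ g ⨾ j ⨾ j⁻¹       ≈⟨ refl⟩⨾⟨ pullˡ (≈.sym sq) ⟩
    i⁻¹ ⨾ (i ⨾ f) ⨾ j⁻¹     ≈⟨ refl⟩⨾⟨ ⨾-assoc ⟩
    i⁻¹ ⨾ i ⨾ f ⨾ j⁻¹       ≈⟨ cancelˡ ii⁻¹ ⟩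
    f ⨾ j⁻¹                 ∎

  precompose-inverse⇔ : ∀ {X Y} {i : Hom X Y} {j : Hom Y X} {a : Hom X Y} →
    i ⨾ j ≈ id → j ⨾ i ≈ id → (a ⨾ j ≈ id ⇔ a ≈ i)
  precompose-inverse⇔ {i = i} {j} {a} ij ji = mk⇔ to from
    where
    to : a ⨾ j ≈ id → a ≈ i
    to aj = begin
      a             ≈⟨ ≈.sym idʳ ⟩
      a ⨾ id        ≈⟨ refl⟩⨾⟨ ≈.sym ji ⟩
      a ⨾ j ⨾ i     ≈⟨ pullˡ aj ⟩
      id ⨾ i        ≈⟨ idˡ ⟩
      i             ∎
    from : a ≈ i → a ⨾ j ≈ id
    from a≈i = ≈.trans (a≈i ⟩⨾⟨refl) ij

module MonoidalLemmas {o ℓ e : Level} (C : Category o ℓ e) (M : SymmetricMonoidal C) where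
  open Category C
  open SymmetricMonoidal M
  open CategoryReasoning C

  ru⁻¹-nat : ∀ {X Y} {f : Hom X Y} → ru⁻¹ X ⨾ f ≈ (f ⊗₁ id) ⨾ ru⁻¹ Y
  ru⁻¹-nat = inverse-square ru-iso₂ ru-iso₁ (≈.sym ru-nat)

module MonadLemmas {o ℓ e : Level} (C : Category o ℓ e) (M : SymmetricMonoidal C)
    (T : SymmetricMonoidalMonad C M) where
  open Category C
  open SymmetricMonoidal M
  open SymmetricMonoidalMonad T
  open CategoryReasoning C

  T-inverse : ∀ {X Y} {f : Hom X Y} {g : Hom Y X} → f ⨾ g ≈ id → T₁ f ⨾ T₁ g ≈ id
  T-inverse fg = ≈.trans (≈.sym T-⨾) (≈.trans (T-cong fg) T-id)

  η-⨾-bind : ∀ {X Y Z} {a : Hom X Y} {g : Hom Y (T₀ Z)} → (a ⨾ η Y) ⨾ T₁ g ⨾ μ Z ≈ a ⨾ g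
  η-⨾-bind {Y = Y} {Z} {a} {g} = begin
    (a ⨾ η Y) ⨾ T₁ g ⨾ μ Z      ≈⟨ ⨾-assoc ⟩
    a ⨾ η Y ⨾ T₁ g ⨾ μ Z        ≈⟨ refl⟩⨾⟨ pullˡ (≈.sym η-nat) ⟩
    a ⨾ (g ⨾ η (T₀ Z)) ⨾ μ Z    ≈⟨ refl⟩⨾⟨ ⨾-assoc ⟩
    a ⨾ g ⨾ η (T₀ Z) ⨾ μ Z      ≈⟨ refl⟩⨾⟨ refl⟩⨾⟨ μ-idˡ ⟩
    a ⨾ g ⨾ id                  ≈⟨ refl⟩⨾⟨ idʳ ⟩
    a ⨾ g                       ∎

  T-⨾η-μ : ∀ {Y Z} {g : Hom Y Z} → T₁ (g ⨾ η Z) ⨾ μ Z ≈ T₁ g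
  T-⨾η-μ = ≈.trans (T-⨾ ⟩⨾⟨refl) (≈.trans ⨾-assoc (≈.trans (refl⟩⨾⟨ μ-idʳ) idʳ))

  ru⁻¹-via-c : ∀ {X} → ru⁻¹ (T₀ X) ≈ ((id ⊗₁ η I) ⨾ c X I) ⨾ T₁ (ru⁻¹ X)
  ru⁻¹-via-c = ≈.trans (≈.sym idʳ)
    (inverse-square ru-iso₂ (T-inverse ru-iso₁) (≈.trans c-unitʳ (≈.sym idˡ)))

  T-ru⁻¹-μ : ∀ {X} →
    T₁ (ru⁻¹ (T₀ X)) ⨾ μ X ≈ T₁ ((id ⊗₁ η I) ⨾ c X I) ⨾ μ (X ⊗₀ I) ⨾ T₁ (ru⁻¹ X)
  T-ru⁻¹-μ {X} = begin
    T₁ (ru⁻¹ (T₀ X)) ⨾ μ X                                   ≈⟨ T-cong ru⁻¹-via-c ⟩⨾⟨refl ⟩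
    T₁ (((id ⊗₁ η I) ⨾ c X I) ⨾ T₁ (ru⁻¹ X)) ⨾ μ X            ≈⟨ T-⨾ ⟩⨾⟨refl ⟩
    (T₁ ((id ⊗₁ η I) ⨾ c X I) ⨾ T₁ (T₁ (ru⁻¹ X))) ⨾ μ X      ≈⟨ ⨾-assoc ⟩
    T₁ ((id ⊗₁ η I) ⨾ c X I) ⨾ T₁ (T₁ (ru⁻¹ X)) ⨾ μ X        ≈⟨ refl⟩⨾⟨ μ-nat ⟩
    T₁ ((id ⊗₁ η I) ⨾ c X I) ⨾ μ (X ⊗₀ I) ⨾ T₁ (ru⁻¹ X)      ∎

  η⊗id-c-bind : ∀ {X Y} →
    (η (T₀ X) ⊗₁ id) ⨾ c (T₀ X) Y ⨾ T₁ ((id ⊗₁ η Y) ⨾ c X Y) ⨾ μ (X ⊗₀ Y) ≈ c X Y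
  η⊗id-c-bind {X} {Y} = begin
    (η (T₀ X) ⊗₁ id) ⨾ c (T₀ X) Y ⨾ T₁ ((id ⊗₁ η Y) ⨾ c X Y) ⨾ μ (X ⊗₀ Y)
      ≈⟨ refl⟩⨾⟨ refl⟩⨾⟨ ≈.trans (T-⨾ ⟩⨾⟨refl) ⨾-assoc ⟩
    (η (T₀ X) ⊗₁ id) ⨾ c (T₀ X) Y ⨾ T₁ (id ⊗₁ η Y) ⨾ T₁ (c X Y) ⨾ μ (X ⊗₀ Y)
      ≈⟨ refl⟩⨾⟨ extendˡ (≈.sym c-nat) ⟩
    (η (T₀ X) ⊗₁ id) ⨾ (T₁ id ⊗₁ T₁ (η Y)) ⨾ c (T₀ X) (T₀ Y) ⨾ T₁ (c X Y) ⨾ μ (X ⊗₀ Y)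
      ≈⟨ pullˡ (≈.trans (≈.sym ⊗-⨾) (⊗-cong (≈.trans (refl⟩⨾⟨ T-id) idʳ) idˡ)) ⟩
    (η (T₀ X) ⊗₁ T₁ (η Y)) ⨾ c (T₀ X) (T₀ Y) ⨾ T₁ (c X Y) ⨾ μ (X ⊗₀ Y)
      ≈⟨ refl⟩⨾⟨ ≈.sym μ-monoidal ⟩
    (η (T₀ X) ⊗₁ T₁ (η Y)) ⨾ (μ X ⊗₁ μ Y) ⨾ c X Y
      ≈⟨ pullˡ (≈.trans (≈.sym ⊗-⨾) (≈.trans (⊗-cong μ-idˡ μ-idʳ) ⊗-id)) ⟩
    id ⨾ c X Y
      ≈⟨ idˡ ⟩
    c X Y ∎

module KleisliMass {o ℓ e : Level} (C : Category o ℓ e) (M : SymmetricMonoidal C)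
    (G : GsMonoidal C M) (T : SymmetricMonoidalMonad C M) where
  open Category C
  open SymmetricMonoidal M
  open GsMonoidal G
  open SymmetricMonoidalMonad T
  open CategoryReasoning C
  open MonoidalLemmas C M
  open MonadLemmas C M T
  module Kl = GsData (Kleisli C M G T)

  domOfMass : ∀ {X} → Hom X (T₀ I) → Hom X (T₀ X)
  domOfMass {X} m = ∇ X ⨾ (η X ⊗₁ m) ⨾ c X I ⨾ T₁ (ru⁻¹ X)

  dom≈domOfMass : ∀ {X Y} (f : Hom X (T₀ Y)) → Kl.dom f ≈ domOfMass (Kl.mass f)
  dom≈domOfMass f = ≈.trans (η-⨾-bind ⟩⨾⟨ T-⨾η-μ) (≈.trans ⨾-assoc (refl⟩⨾⟨ ⨾-assoc))

  domOfMass-⨾ : ∀ {X} {m : Hom X (T₀ I)} → m ⨾ ∇ (T₀ I) ≈ ∇ X ⨾ (m ⊗₁ m) →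
    domOfMass m ⨾ T₁ m ⨾ μ I ≈ m ⨾ domOfMass id ⨾ μ I
  domOfMass-⨾ {X} {m} copy = begin
    domOfMass m ⨾ T₁ m ⨾ μ I
      ≈⟨ ⨾-assoc₃ ⟩
    ∇ X ⨾ (η X ⊗₁ m) ⨾ c X I ⨾ T₁ (ru⁻¹ X) ⨾ T₁ m ⨾ μ I
      ≈⟨ refl⟩⨾⟨ refl⟩⨾⟨ refl⟩⨾⟨ extendˡ T-ru⁻¹-slide ⟩
    ∇ X ⨾ (η X ⊗₁ m) ⨾ c X I ⨾ T₁ (m ⊗₁ id) ⨾ T₁ (ru⁻¹ (T₀ I)) ⨾ μ I
      ≈⟨ refl⟩⨾⟨ refl⟩⨾⟨ extendˡ (≈.sym c-nat) ⟩
    ∇ X ⨾ (η X ⊗₁ m) ⨾ (T₁ m ⊗₁ T₁ id) ⨾ c (T₀ I) I ⨾ T₁ (ru⁻¹ (T₀ I)) ⨾ μ I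
      ≈⟨ refl⟩⨾⟨ extendˡ η⊗m-slide ⟩
    ∇ X ⨾ (m ⊗₁ m) ⨾ (η (T₀ I) ⊗₁ id) ⨾ c (T₀ I) I ⨾ T₁ (ru⁻¹ (T₀ I)) ⨾ μ I
      ≈⟨ extendˡ (≈.sym copy) ⟩
    m ⨾ ∇ (T₀ I) ⨾ (η (T₀ I) ⊗₁ id) ⨾ c (T₀ I) I ⨾ T₁ (ru⁻¹ (T₀ I)) ⨾ μ I
      ≈⟨ refl⟩⨾⟨ ≈.sym ⨾-assoc₃ ⟩
    m ⨾ domOfMass id ⨾ μ I ∎
    where
    T-ru⁻¹-slide : T₁ (ru⁻¹ X) ⨾ T₁ m ≈ T₁ (m ⊗₁ id) ⨾ T₁ (ru⁻¹ (T₀ I))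
    T-ru⁻¹-slide = ≈.trans (≈.sym T-⨾) (≈.trans (T-cong ru⁻¹-nat) T-⨾)
    η⊗m-slide : (η X ⊗₁ m) ⨾ (T₁ m ⊗₁ T₁ id) ≈ (m ⊗₁ m) ⨾ (η (T₀ I) ⊗₁ id)
    η⊗m-slide = ≈.trans (≈.sym ⊗-⨾) (≈.trans (⊗-cong (≈.sym η-nat) (refl⟩⨾⟨ T-id)) ⊗-⨾)

  unitDomain : Hom (T₀ I) (T₀ I)
  unitDomain = (∇ (T₀ I) ⨾ c I I) ⨾ T₁ (ru⁻¹ I)

  domOfMass-id : domOfMass id ⨾ μ I ≈ unitDomain
  domOfMass-id = begin
    domOfMass id ⨾ μ I
      ≈⟨ ⨾-assoc₃ ⟩
    ∇ (T₀ I) ⨾ (η (T₀ I) ⊗₁ id) ⨾ c (T₀ I) I ⨾ T₁ (ru⁻¹ (T₀ I)) ⨾ μ I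
      ≈⟨ refl⟩⨾⟨ refl⟩⨾⟨ refl⟩⨾⟨ T-ru⁻¹-μ ⟩
    ∇ (T₀ I) ⨾ (η (T₀ I) ⊗₁ id) ⨾ c (T₀ I) I ⨾ T₁ ((id ⊗₁ η I) ⨾ c I I) ⨾ μ (I ⊗₀ I) ⨾ T₁ (ru⁻¹ I)
      ≈⟨ refl⟩⨾⟨ ≈.trans (≈.sym ⨾-assoc₃) (η⊗id-c-bind ⟩⨾⟨refl) ⟩
    ∇ (T₀ I) ⨾ c I I ⨾ T₁ (ru⁻¹ I)
      ≈⟨ ≈.sym ⨾-assoc ⟩
    unitDomain ∎

  udp⇔unitDomain≈id : UnitalDomainPreserving C M G T ⇔ unitDomain ≈ id
  udp⇔unitDomain≈id = mk⇔ (λ udp → P.from (≈.trans (≈.sym udp-lhs) udp))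
                          (λ u → ≈.trans udp-lhs (P.to u))
    where
    module P = Equivalence (precompose-inverse⇔ (T-inverse ru-iso₁) (T-inverse ru-iso₂))
    udp-lhs : ∇ (T₀ I) ⨾ c I I ⨾ T₁ (id ⊗₁ ! I) ≈ ∇ (T₀ I) ⨾ c I I
    udp-lhs = ≈.trans (≈.sym ⨾-assoc)
      (≈.trans (refl⟩⨾⟨ ≈.trans (T-cong (≈.trans (⊗-cong ≈.refl !-I) ⊗-id)) T-id) idʳ)

  -- id here is id_TI read as a Kleisli arrow TI → I, not the Kleisli identity η.
  mass-id : Kl.mass (id {T₀ I}) ≈ id
  mass-id = ≈.trans idˡ (≈.trans (T-cong (≈.trans (!-I ⟩⨾⟨refl) idˡ) ⟩⨾⟨refl) μ-idʳ)

  dom-⨾-mass : IsRestriction C M G → ∀ {X Y} (f : Hom X (T₀ Y)) →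
    Kl.dom f Kl.⨾ Kl.mass f ≈ Kl.mass f ⨾ unitDomain
  dom-⨾-mass R f = begin
    Kl.dom f Kl.⨾ m               ≈⟨ dom≈domOfMass f ⟩⨾⟨refl ⟩
    domOfMass m ⨾ T₁ m ⨾ μ I      ≈⟨ domOfMass-⨾ (R m) ⟩
    m ⨾ domOfMass id ⨾ μ I        ≈⟨ refl⟩⨾⟨ domOfMass-id ⟩
    m ⨾ unitDomain                ∎
    where m = Kl.mass f

  unitDomain≈id⇔mass : IsRestriction C M G →
    unitDomain ≈ id ⇔ IsMassCategory (Kleisli C M G T)
  unitDomain≈id⇔mass R = mk⇔ to from
    where
    to : unitDomain ≈ id → IsMassCategory (Kleisli C M G T)
    to u f = ≈.trans (dom-⨾-mass R f) (≈.trans (refl⟩⨾⟨ u) idʳ)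
    from : IsMassCategory (Kleisli C M G T) → unitDomain ≈ id
    from mass = begin
      unitDomain                       ≈⟨ ≈.sym idˡ ⟩
      id ⨾ unitDomain                  ≈⟨ ≈.sym mass-id ⟩⨾⟨refl ⟩
      Kl.mass id ⨾ unitDomain          ≈⟨ ≈.sym (dom-⨾-mass R id) ⟩
      Kl.dom id Kl.⨾ Kl.mass id        ≈⟨ mass id ⟩
      Kl.mass id                       ≈⟨ mass-id ⟩
      id                               ∎

corollary5p5 : ∀ {o ℓ e : Level} (C : Category o ℓ e) (M : SymmetricMonoidal C)
    (G : GsMonoidal C M) → IsRestriction C M G → (T : SymmetricMonoidalMonad C M) →
    UnitalDomainPreserving C M G T ⇔ IsMassCategory (Kleisli C M G T)
corollary5p5 C M G R T = unitDomain≈id⇔mass R ⇔-∘ udp⇔unitDomain≈id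
  where open KleisliMass C M G T
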